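{- A sentential logic is monotonic and transitive if and only if it has a truth-adequate intersective $q$-mixed semantics.
   Context: A sentential logic is a triple $\langle\mathcal{L},\mathcal{C},\vdash\rangle$ where $\mathcal{L}$ is the set of formulae freely generated from a set of atoms by a (possibly empty) set $\mathcal{C}$ of connectives, and $\vdash\subseteq\mathcal{P}(\mathcal{L})\times\mathcal{P}(\mathcal{L})$. It is monotonic if $\Gamma_1\subseteq\Gamma_2$, $\Delta_1\subseteq\Delta_2$, $\Gamma_1\vdash\Delta_1$ imply $\Gamma_2\vdash\Delta_2$; transitive if whenever $\Gamma\not\vdash\Delta$ there are $\Gamma'\supseteq\Gamma$ and $\Delta'\supseteq\Delta$ with $\Gamma'\not\vdash\Delta'$ and $\Gamma'\cup\Delta'=\mathcal{L}$. A semantics is a triple $\langle\mathcal{V},\mathcal{W},[\![\cdot]\!]\rangle$: truth values $\mathcal{V}$, worlds $\mathcal{W}$, and $[\![\cdot]\!]$ assigning to formulae propositions $\mathcal{W}\to\mathcal{V}$, to $n$-ary connectives functions on $n$-tuples of propositions, and to $\vdash$ a relation $\models$ between sets of propositions. It is compositional if $[\![c(F_1,\dots,F_n)]\!]=[\![c]\!]([\![F_1]\!],\dots,[\![F_n]\!])$; sound and complete if $\Gamma\vdash\Delta$ iff $\{[\![F]\!]:F\in\Gamma\}\models\{[\![F]\!]:F\in\Delta\}$; truth-functional if for each $n$-ary $c$ there is $f_c:\mathcal{V}^n\to\mathcal{V}$ with $[\![c]\!](P_1,\dots,P_n)(w)=f_c(P_1(w),\dots,P_n(w))$; truth-relational if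 there is $\Vdash\subseteq\mathcal{P}(\mathcal{V})\times\mathcal{P}(\mathcal{V})$ (the truth-relation) with $S\models P$ iff $S(w)\Vdash P(w)$ for all $w$, where $S(w)=\{Q(w):Q\in S\}$; truth-adequate if it has all four properties. For $D_p,D_c\subseteq\mathcal{V}$, $\gamma\Vdash_{D_p,D_c}\delta$ iff ($\gamma\subseteq D_p$ implies $\delta\cap D_c\neq\emptyset$); such a relation is $q$-mixed if $D_c\subseteq D_p$. A semantics is intersective $q$-mixed if it is truth-relational and its truth-relation is the intersection of a (possibly empty; the empty intersection being $\mathcal{P}(\mathcal{V})\times\mathcal{P}(\mathcal{V})$) family of $q$-mixed relations. -}

module Defs where

open import Level using (Level; 0ℓ; _⊔_) renaming (suc to lsuc)
open import Data.Nat using (ℕ)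
open import Data.Fin using (Fin)
open import Data.Product using (Σ; ∃; ∃-syntax; _×_; _,_)
open import Data.Sum using (_⊎_)
open import Relation.Unary using (Pred; _⊆_; _∈_)
open import Relation.Binary.PropositionalEquality using (_≡_)
open import Relation.Nullary using (¬_)
open import Function.Bundles using (_⇔_)

record Signature : Set₁ where
  field
    Atom  : Set
    Conn  : Set
    arity : Conn → ℕ

data Formula (σ : Signature) : Set where
  atom : Signature.Atom σ → Formula σ
  app  : (c : Signature.Conn σ) → (Fin (Signature.arity σ c) → Formula σ) → Formula σ

record SententialLogic : Set₁ where
  field
    sig : Signature
    _⊢_ : Pred (Formula sig) 0ℓ → Pred (Formula sig) 0ℓ → Set
  open Signature sig public

module _ (𝓛 : SententialLogic) where
  open SententialLogic 𝓛

  Monotonic : Set₁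
  Monotonic = ∀ (Γ₁ Γ₂ Δ₁ Δ₂ : Pred (Formula sig) 0ℓ) →
    Γ₁ ⊆ Γ₂ → Δ₁ ⊆ Δ₂ → Γ₁ ⊢ Δ₁ → Γ₂ ⊢ Δ₂

  -- Γ' ∪ Δ' = ℒ  is rendered as: every formula is in Γ' or in Δ'
  Transitive : Set₁
  Transitive = ∀ (Γ Δ : Pred (Formula sig) 0ℓ) → ¬ (Γ ⊢ Δ) →
    ∃[ Γ' ] ∃[ Δ' ] (Γ ⊆ Γ' × Δ ⊆ Δ' × ¬ (Γ' ⊢ Δ') × (∀ F → F ∈ Γ' ⊎ F ∈ Δ'))

record Semantics (𝓛 : SententialLogic) (ℓ : Level) : Set (lsuc ℓ) where
  open SententialLogic 𝓛
  field
    V    : Set ℓ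
    W    : Set ℓ
    ⟦_⟧  : Formula sig → (W → V)
    ⟦_⟧ᶜ : (c : Conn) → (Fin (arity c) → (W → V)) → (W → V)
    _⊨_  : Pred (W → V) ℓ → Pred (W → V) ℓ → Set ℓ

  image : Pred (Formula sig) 0ℓ → Pred (W → V) ℓ
  image Γ Q = ∃[ F ] (F ∈ Γ × ⟦ F ⟧ ≡ Q)

  _at_ : Pred (W → V) ℓ → W → Pred V ℓ
  (S at w) v = ∃[ Q ] (Q ∈ S × Q w ≡ v)

  -- equality of propositions (functions W → V) is taken pointwise
  Compositional : Set ℓ
  Compositional = ∀ (c : Conn) (Fs : Fin (arity c) → Formula sig) (w : W) →
    ⟦ app c Fs ⟧ w ≡ ⟦ c ⟧ᶜ (λ i → ⟦ Fs i ⟧) w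

  SoundComplete : Set (lsuc 0ℓ ⊔ ℓ)
  SoundComplete = ∀ (Γ Δ : Pred (Formula sig) 0ℓ) →
    (Γ ⊢ Δ) ⇔ (image Γ ⊨ image Δ)

  TruthFunctional : Set ℓ
  TruthFunctional = ∀ (c : Conn) → Σ ((Fin (arity c) → V) → V) λ f → (∀ (Ps : Fin (arity c) → (W → V)) (w : W) →
    ⟦ c ⟧ᶜ Ps w ≡ f (λ i → Ps i w))

  TruthRelationalVia : (Pred V ℓ → Pred V ℓ → Set ℓ) → Set (lsuc ℓ)
  TruthRelationalVia _⊩_ = ∀ (S P : Pred (W → V) ℓ) →
    (S ⊨ P) ⇔ (∀ (w : W) → (S at w) ⊩ (P at w))

  TruthRelational : Set (lsuc ℓ)
  TruthRelational = ∃[ ⊩ ] TruthRelationalVia ⊩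

  ⊩[_,_] : Pred V ℓ → Pred V ℓ → Pred V ℓ → Pred V ℓ → Set ℓ
  ⊩[ Dp , Dc ] γ δ = γ ⊆ Dp → ∃[ v ] (v ∈ δ × v ∈ Dc)

  IntersectiveQMixed : Set (lsuc ℓ)
  IntersectiveQMixed =
    Σ (Set ℓ) λ I → Σ (I → Pred V ℓ) λ Dp → Σ (I → Pred V ℓ) λ Dc →
      (∀ i → Dc i ⊆ Dp i) ×
      TruthRelationalVia (λ γ δ → ∀ i → ⊩[ Dp i , Dc i ] γ δ)

  TruthAdequateIntersectiveQMixed : Set (lsuc 0ℓ ⊔ lsuc ℓ)
  TruthAdequateIntersectiveQMixed =
    Compositional × SoundComplete × TruthFunctional × IntersectiveQMixed

-- Every q-mixed relation ⊩[Dp, Dc] is antitone on the left and monotone on the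
-- right, so a sound and complete intersective q-mixed semantics makes ⊢
-- monotonic. If Γ ⊬ Δ, some world w and relation (Dp, Dc) refute it, and then
-- Γ' = {F | ⟦F⟧ w ∈ Dp}, Δ' = {F | ⟦F⟧ w ∉ Dc} is again refuted there, extends
-- (Γ, Δ), and covers ℒ because Dc ⊆ Dp: this is transitivity.
-- Conversely, in a monotonic transitive logic Γ ⊢ Δ holds iff every saturated
-- pair (Γ', Δ') (Γ' ⊬ Δ', Γ' ∪ Δ' = ℒ) with Γ ⊆ Γ' leaves some formula of Δ
-- outside Δ'. So the canonical semantics with formulae as truth values, one
-- world, connectives acting syntactically, and one q-mixed relation
-- (Γ', ℒ ∖ Δ') per saturated pair is truth-adequate.
module Submission where

open import Defs
open import Level using (Level; Lift; lift; lower; 0ℓ) renaming (suc to lsuc)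
open import Data.Product using (Σ; _×_; _,_; ∃-syntax; map₂)
open import Data.Sum using (_⊎_; inj₁; inj₂)
open import Data.Unit using (⊤; tt)
open import Data.Empty using (⊥-elim)
open import Function using (_∘_; id)
open import Function.Bundles using (_⇔_; mk⇔; Equivalence)
open import Axiom.ExcludedMiddle using (ExcludedMiddle)
open import Axiom.DoubleNegationElimination using (em⇒dne)
open import Relation.Nullary using (¬_; yes; no)
open import Relation.Nullary.Decidable using (True; False; toWitness; fromWitness; toWitnessFalse; fromWitnessFalse)
open import Relation.Binary.PropositionalEquality using (_≡_; refl)
open import Relation.Unary using (Pred; _⊆_; _∈_; _∉_)

open Equivalence using (to; from)

module _ (𝓛 : SententialLogic) where
  open SententialLogic 𝓛

  Saturated : Pred (Formula sig) 0ℓ → Pred (Formula sig) 0ℓ → Set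
  Saturated Γ Δ = ¬ (Γ ⊢ Δ) × (∀ F → F ∈ Γ ⊎ F ∈ Δ)

module _ {𝓛 : SententialLogic} {ℓ : Level} (sem : Semantics 𝓛 ℓ) where
  open SententialLogic 𝓛
  open Semantics sem

  ⊩ᶠ[_,_] : Pred V ℓ → Pred V ℓ → W → Pred (Formula sig) 0ℓ → Pred (Formula sig) 0ℓ → Set ℓ
  ⊩ᶠ[ Dp , Dc ] w Γ Δ = (∀ {F} → F ∈ Γ → ⟦ F ⟧ w ∈ Dp) → ∃[ F ] (F ∈ Δ × ⟦ F ⟧ w ∈ Dc)

  ⊩-image⇔⊩ᶠ : ∀ {Dp Dc w Γ Δ} →
    ⊩[ Dp , Dc ] (image Γ at w) (image Δ at w) ⇔ ⊩ᶠ[ Dp , Dc ] w Γ Δ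
  ⊩-image⇔⊩ᶠ {Dp} {Dc} {w} {Γ} {Δ} = mk⇔ to′ from′
    where
    to′ : ⊩[ Dp , Dc ] (image Γ at w) (image Δ at w) → ⊩ᶠ[ Dp , Dc ] w Γ Δ
    to′ ⊩γδ Γ⊆Dp with ⊩γδ (λ where (_ , (_ , F∈Γ , refl) , refl) → Γ⊆Dp F∈Γ)
    ... | _ , (_ , (F , F∈Δ , refl) , refl) , F∈Dc = F , F∈Δ , F∈Dc

    from′ : ⊩ᶠ[ Dp , Dc ] w Γ Δ → ⊩[ Dp , Dc ] (image Γ at w) (image Δ at w)
    from′ ⊩ᶠΓΔ γ⊆Dp with ⊩ᶠΓΔ (λ {F} F∈Γ → γ⊆Dp (⟦ F ⟧ , (F , F∈Γ , refl) , refl))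
    ... | F , F∈Δ , F∈Dc = ⟦ F ⟧ w , (⟦ F ⟧ , (F , F∈Δ , refl) , refl) , F∈Dc

  ⊩ᶠ-mono : ∀ {Dp Dc w Γ₁ Γ₂ Δ₁ Δ₂} → Γ₁ ⊆ Γ₂ → Δ₁ ⊆ Δ₂ →
    ⊩ᶠ[ Dp , Dc ] w Γ₁ Δ₁ → ⊩ᶠ[ Dp , Dc ] w Γ₂ Δ₂
  ⊩ᶠ-mono Γ₁⊆Γ₂ Δ₁⊆Δ₂ ⊩ᶠΓ₁Δ₁ Γ₂⊆Dp =
    let (F , F∈Δ₁ , F∈Dc) = ⊩ᶠΓ₁Δ₁ (Γ₂⊆Dp ∘ Γ₁⊆Γ₂) in F , Δ₁⊆Δ₂ F∈Δ₁ , F∈Dc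

module _ (em : ∀ {a} → ExcludedMiddle a) where

  private
    dne : ∀ {a} {P : Set a} → ¬ ¬ P → P
    dne = em⇒dne em

  module _ {𝓛 : SententialLogic} {ℓ : Level} {sem : Semantics 𝓛 ℓ}
    (sound-complete : Semantics.SoundComplete sem)
    {I : Set ℓ} {Dp Dc : I → Pred (Semantics.V sem) ℓ} (Dc⊆Dp : ∀ i → Dc i ⊆ Dp i)
    (truth-relational : Semantics.TruthRelationalVia sem (λ γ δ → ∀ i → Semantics.⊩[_,_] sem (Dp i) (Dc i) γ δ))
    where
    open SententialLogic 𝓛
    open Semantics sem

    ⊢⇔⊩ᶠ : ∀ {Γ Δ} → Γ ⊢ Δ ⇔ (∀ w i → ⊩ᶠ[_,_] sem (Dp i) (Dc i) w Γ Δ)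
    ⊢⇔⊩ᶠ {Γ} {Δ} = mk⇔
      (λ Γ⊢Δ w i → to (⊩-image⇔⊩ᶠ sem) (to pointwise (to (sound-complete Γ Δ) Γ⊢Δ) w i))
      (λ ⊩ᶠΓΔ → from (sound-complete Γ Δ) (from pointwise λ w i → from (⊩-image⇔⊩ᶠ sem) (⊩ᶠΓΔ w i)))
      where pointwise = truth-relational (image Γ) (image Δ)

    qmixed-monotonic : Monotonic 𝓛
    qmixed-monotonic Γ₁ Γ₂ Δ₁ Δ₂ Γ₁⊆Γ₂ Δ₁⊆Δ₂ Γ₁⊢Δ₁ =
      from ⊢⇔⊩ᶠ λ w i → ⊩ᶠ-mono sem {Dp i} {Dc i} Γ₁⊆Γ₂ Δ₁⊆Δ₂ (to ⊢⇔⊩ᶠ Γ₁⊢Δ₁ w i)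

    counterexample⇒saturated : ∀ {Γ Δ : Pred (Formula sig) 0ℓ} w i →
      (∀ {F} → F ∈ Γ → ⟦ F ⟧ w ∈ Dp i) →
      ¬ (∃[ F ] (F ∈ Δ × ⟦ F ⟧ w ∈ Dc i)) →
      ∃[ Γ' ] ∃[ Δ' ] (Γ ⊆ Γ' × Δ ⊆ Δ' × Saturated 𝓛 Γ' Δ')
    counterexample⇒saturated {Γ} {Δ} w i Γ⊆Dp Δ∩Dc≡∅ = Γ' , Δ' , Γ⊆Γ' , Δ⊆Δ' , Γ'⊬Δ' , cover
      where
      -- Reflecting the decisions of em through True/False keeps Γ' and Δ'
      -- at level 0, whatever the level of the truth values.
      Γ' Δ' : Pred (Formula sig) 0ℓ
      Γ' F = True (em {P = ⟦ F ⟧ w ∈ Dp i})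
      Δ' F = False (em {P = ⟦ F ⟧ w ∈ Dc i})

      Γ⊆Γ' : Γ ⊆ Γ'
      Γ⊆Γ' = fromWitness ∘ Γ⊆Dp

      Δ⊆Δ' : Δ ⊆ Δ'
      Δ⊆Δ' {F} F∈Δ = fromWitnessFalse {a? = em} λ F∈Dc → Δ∩Dc≡∅ (F , F∈Δ , F∈Dc)

      Γ'⊬Δ' : ¬ (Γ' ⊢ Δ')
      Γ'⊬Δ' Γ'⊢Δ' with to ⊢⇔⊩ᶠ Γ'⊢Δ' w i toWitness
      ... | F , F∈Δ' , F∈Dc = toWitnessFalse F∈Δ' F∈Dc

      cover : ∀ F → F ∈ Γ' ⊎ F ∈ Δ'
      cover F with em {P = ⟦ F ⟧ w ∈ Dc i}
      ... | yes F∈Dc = inj₁ (fromWitness (Dc⊆Dp i F∈Dc))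
      ... | no F∉Dc = inj₂ (fromWitnessFalse {a? = no F∉Dc} F∉Dc)

    qmixed-transitive : Transitive 𝓛
    qmixed-transitive Γ Δ Γ⊬Δ = dne λ no-extension →
      Γ⊬Δ (from ⊢⇔⊩ᶠ λ w i Γ⊆Dp → dne λ Δ∩Dc≡∅ →
        no-extension (counterexample⇒saturated w i Γ⊆Dp Δ∩Dc≡∅))


  sound-qmixed⇒monotonic×transitive : ∀ {𝓛 ℓ} {sem : Semantics 𝓛 ℓ} →
    Semantics.SoundComplete sem → Semantics.IntersectiveQMixed sem → Monotonic 𝓛 × Transitive 𝓛
  sound-qmixed⇒monotonic×transitive {sem = sem} sound-complete (_ , Dp , Dc , Dc⊆Dp , truth-relational) =
      qmixed-monotonic {sem = sem} sound-complete {Dp = Dp} {Dc} Dc⊆Dp truth-relational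
    , qmixed-transitive {sem = sem} sound-complete {Dp = Dp} {Dc} Dc⊆Dp truth-relational

  module _ {𝓛 : SententialLogic} (monotonic : Monotonic 𝓛) (transitive : Transitive 𝓛) where
    open SententialLogic 𝓛

    ⊢⇔saturated-separated : ∀ {Γ Δ} → Γ ⊢ Δ ⇔
      (∀ Γ' Δ' → Saturated 𝓛 Γ' Δ' → Γ ⊆ Γ' → ∃[ F ] (F ∈ Δ × F ∉ Δ'))
    ⊢⇔saturated-separated {Γ} {Δ} = mk⇔ separated entails
      where
      separated : Γ ⊢ Δ → ∀ Γ' Δ' → Saturated 𝓛 Γ' Δ' → Γ ⊆ Γ' → ∃[ F ] (F ∈ Δ × F ∉ Δ')
      separated Γ⊢Δ Γ' Δ' (Γ'⊬Δ' , _) Γ⊆Γ' = dne λ Δ∖Δ'≡∅ →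
        Γ'⊬Δ' (monotonic Γ Γ' Δ Δ' Γ⊆Γ'
                 (λ {F} F∈Δ → dne λ F∉Δ' → Δ∖Δ'≡∅ (F , F∈Δ , F∉Δ')) Γ⊢Δ)

      entails : (∀ Γ' Δ' → Saturated 𝓛 Γ' Δ' → Γ ⊆ Γ' → ∃[ F ] (F ∈ Δ × F ∉ Δ')) → Γ ⊢ Δ
      entails sep = dne λ Γ⊬Δ →
        let (Γ' , Δ' , Γ⊆Γ' , Δ⊆Δ' , saturated) = transitive Γ Δ Γ⊬Δ
            (F , F∈Δ , F∉Δ') = sep Γ' Δ' saturated Γ⊆Γ'
        in F∉Δ' (Δ⊆Δ' F∈Δ)

    module Canonical (ℓ : Level) where
      Index : Set₁
      Index = Σ (Pred (Formula sig) 0ℓ) λ Γ' → Σ (Pred (Formula sig) 0ℓ) λ Δ' → Saturated 𝓛 Γ' Δ'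

      Value World I : Set (lsuc ℓ)
      Value = Lift (lsuc ℓ) (Formula sig)
      World = Lift (lsuc ℓ) ⊤
      I = Lift (lsuc ℓ) Index

      Dp Dc : I → Pred Value (lsuc ℓ)
      Dp (lift (Γ' , _)) (lift F) = Lift (lsuc ℓ) (F ∈ Γ')
      Dc (lift (_ , Δ' , _)) (lift F) = Lift (lsuc ℓ) (F ∉ Δ')

      Dc⊆Dp : ∀ i → Dc i ⊆ Dp i
      Dc⊆Dp (lift (_ , _ , _ , cover)) {lift F} (lift F∉Δ') with cover F
      ... | inj₁ F∈Γ' = lift F∈Γ'
      ... | inj₂ F∈Δ' = ⊥-elim (F∉Δ' F∈Δ')

      -- Semantics._at_, which cannot be used before the record exists.
      _at′_ : Pred (World → Value) (lsuc ℓ) → World → Pred Value (lsuc ℓ)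
      (S at′ w) v = ∃[ Q ] (Q ∈ S × Q w ≡ v)

      semantics : Semantics 𝓛 (lsuc ℓ)
      semantics = record
        { V = Value
        ; W = World
        ; ⟦_⟧ = λ F _ → lift F
        ; ⟦_⟧ᶜ = λ c Ps w → lift (app c (λ j → lower (Ps j w)))
        ; _⊨_ = λ S P → ∀ w i → S at′ w ⊆ Dp i → ∃[ v ] (v ∈ P at′ w × v ∈ Dc i)
        }

      module _ (Γ Δ : Pred (Formula sig) 0ℓ) (w : World)
               {Γ' Δ' : Pred (Formula sig) 0ℓ} (saturated : Saturated 𝓛 Γ' Δ') where
        open Semantics semantics using (⊩[_,_]; image; _at_)

        private
          i : I
          i = lift (Γ' , Δ' , saturated)

        ⊩⇔separated : ⊩[ Dp i , Dc i ] (image Γ at w) (image Δ at w) ⇔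
                      (Γ ⊆ Γ' → ∃[ F ] (F ∈ Δ × F ∉ Δ'))
        ⊩⇔separated =
          mk⇔ (separated ∘ to (⊩-image⇔⊩ᶠ semantics)) (from (⊩-image⇔⊩ᶠ semantics) ∘ ⊩ᶠ)
          where
          separated : ⊩ᶠ[_,_] semantics (Dp i) (Dc i) w Γ Δ → Γ ⊆ Γ' → ∃[ F ] (F ∈ Δ × F ∉ Δ')
          separated ⊩ᶠΓΔ Γ⊆Γ' = map₂ (map₂ lower) (⊩ᶠΓΔ (lift ∘ Γ⊆Γ'))

          ⊩ᶠ : (Γ ⊆ Γ' → ∃[ F ] (F ∈ Δ × F ∉ Δ')) → ⊩ᶠ[_,_] semantics (Dp i) (Dc i) w Γ Δ
          ⊩ᶠ separated Γ⊆Dp = map₂ (map₂ lift) (separated (lower ∘ Γ⊆Dp))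

      sound-complete : Semantics.SoundComplete semantics
      sound-complete Γ Δ = mk⇔
        (λ Γ⊢Δ w (lift (Γ' , Δ' , saturated)) →
          from (⊩⇔separated Γ Δ w saturated) (to ⊢⇔saturated-separated Γ⊢Δ Γ' Δ' saturated))
        (λ Γ⊨Δ → from ⊢⇔saturated-separated λ Γ' Δ' saturated →
          to (⊩⇔separated Γ Δ (lift tt) saturated) (Γ⊨Δ (lift tt) (lift (Γ' , Δ' , saturated))))

      truth-adequate : Semantics.TruthAdequateIntersectiveQMixed semantics
      truth-adequate =
          (λ _ _ _ → refl)
        , sound-complete
        , (λ c → (λ vs → lift (app c (lower ∘ vs))) , λ _ _ → refl)
        , I , Dp , Dc , Dc⊆Dp , λ _ _ → mk⇔ id id

theorem3p4 : (∀ {a} → ExcludedMiddle a) → (𝓛 : SententialLogic) → (ℓ : Level) →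
    (Monotonic 𝓛 × Transitive 𝓛) ⇔
      Σ (Semantics 𝓛 (lsuc ℓ)) Semantics.TruthAdequateIntersectiveQMixed
theorem3p4 em 𝓛 ℓ = mk⇔
  (λ (monotonic , transitive) →
    let open Canonical em monotonic transitive ℓ in semantics , truth-adequate)
  (λ (sem , _ , sound-complete , _ , qmixed) →
    sound-qmixed⇒monotonic×transitive em {sem = sem} sound-complete qmixed)
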